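{- Let $H$ be a graph and let $S\subseteq V(H)$ be a set that is both a geodetic set and an edge geodetic set of $H$. Let $k\geq 1$ and let $H'$ be the graph obtained from $H$ by replacing each edge of $H$ by a path with $k$ edges (with new internal vertices). Then $S$ is a geodetic set of $H'$.
   Context: For vertices $u,v$, $I(u,v)$ is the set of vertices on some shortest $u$–$v$ path. A set $S$ is a geodetic set if every vertex lies in $I(u,v)$ for some $u,v\in S$. A set $S$ is an edge geodetic set if every edge of the graph lies on some shortest path between two vertices of $S$. -}

module Defs where

open import Data.Nat using (ℕ; zero; suc; _≤_; _<_; _<?_; s≤s; z≤n)
open import Data.Fin using (Fin) renaming (_<_ to _<ᶠ_)
open import Data.Fin.Subset using (Subset; _∈_)
open import Data.Bool using (Bool; true; false)
open import Data.Sum using (_⊎_; inj₁; inj₂)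
open import Data.Product using (Σ; _×_; _,_; ∃)
open import Relation.Nullary using (¬_; yes; no)
open import Relation.Binary.PropositionalEquality using (_≡_)

record Graph : Set₁ where
  field
    V : Set
    E : V → V → Set

module _ (G : Graph) where
  open Graph G

  data Walk : V → V → ℕ → Set where
    []  : ∀ {x} → Walk x x 0
    _∷_ : ∀ {x y z l} → E x y → Walk y z l → Walk x z (suc l)

  Shortest : ∀ {u v l} → Walk u v l → Set
  Shortest {u} {v} {l} _ = ∀ {l'} → Walk u v l' → l ≤ l'

  data VertexOn (x : V) : ∀ {u v l} → Walk u v l → Set where
    here-[] : VertexOn x ([] {x})
    here-∷  : ∀ {y z l} (e : E x y) (w : Walk y z l) → VertexOn x (e ∷ w)
    there   : ∀ {u y z l} (e : E u y) {w : Walk y z l} → VertexOn x w → VertexOn x (e ∷ w)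

  data StepOn (a b : V) : ∀ {u v l} → Walk u v l → Set where
    here  : ∀ {z l} (e : E a b) (w : Walk b z l) → StepOn a b (e ∷ w)
    there : ∀ {u y z l} (e : E u y) {w : Walk y z l} → StepOn a b w → StepOn a b (e ∷ w)

  EdgeOn : V → V → ∀ {u v l} → Walk u v l → Set
  EdgeOn a b w = StepOn a b w ⊎ StepOn b a w

  Interval : V → V → V → Set
  Interval u v x = Σ ℕ λ l → Σ (Walk u v l) λ w → Shortest w × VertexOn x w

  IsGeodetic : (V → Set) → Set
  IsGeodetic S = ∀ x → Σ V λ u → Σ V λ v → S u × S v × Interval u v x

  IsEdgeGeodetic : (V → Set) → Set
  IsEdgeGeodetic S = ∀ a b → E a b →
    Σ V λ u → Σ V λ v → S u × S v ×
      (Σ ℕ λ l → Σ (Walk u v l) λ w → Shortest w × EdgeOn a b w)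

record SimpleGraph (n : ℕ) : Set where
  field
    adj     : Fin n → Fin n → Bool
    adj-sym : ∀ u v → adj u v ≡ adj v u
    adj-irr : ∀ u → adj u u ≡ false

toGraph : ∀ {n} → SimpleGraph n → Graph
toGraph {n} H = record { V = Fin n ; E = λ u v → SimpleGraph.adj H u v ≡ true }

module Subdivision {n : ℕ} (H : SimpleGraph n) (k : ℕ) where
  open SimpleGraph H

  record HEdge : Set where
    constructor edge
    field
      src tgt : Fin n
      lt      : src <ᶠ tgt
      isEdge  : adj src tgt ≡ true

  -- the internal vertex at position i (0 < i < k) of the path replacing e
  record Inner : Set where
    constructor inner
    field
      e   : HEdge
      pos : ℕ
      pos-pos : 1 ≤ pos
      pos-lt  : pos < k

  V' : Set
  V' = Fin n ⊎ Inner

  -- the vertex at position p (0 ≤ p ≤ k) along the path replacing e: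
  -- position 0 is src e, position k (and beyond) is tgt e
  node : HEdge → ℕ → V'
  node e zero = inj₁ (HEdge.src e)
  node e (suc q) with suc q <? k
  ... | yes q<k = inj₂ (inner e (suc q) (s≤s z≤n) q<k)
  ... | no  _   = inj₁ (HEdge.tgt e)

  E' : V' → V' → Set
  E' x y = Σ HEdge λ e → Σ ℕ λ p → p < k ×
    ((node e p ≡ x × node e (suc p) ≡ y) ⊎ (node e p ≡ y × node e (suc p) ≡ x))

  graph : Graph
  graph = record { V = V' ; E = E' }

subdivide : ∀ {n} → SimpleGraph n → ℕ → Graph
subdivide H k = Subdivision.graph H k

inH : ∀ {n} → Subset n → Fin n → Set
inH S x = x ∈ S

inH' : ∀ {n} (H : SimpleGraph n) (k : ℕ) → Subset n → Subdivision.V' H k → Set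
inH' {n} H k S x = Σ (Fin n) λ u → x ≡ inj₁ u × u ∈ S

module Submission where

-- Subdividing every edge of H into a path of k ≥ 1 edges multiplies all
-- distances between original vertices by k, and every walk of H lifts to a
-- walk of H' running through the whole replacement path of each edge it uses.
-- Hence, for u, v ∈ S:
--   * a shortest u–v path of H lifts to a shortest u–v path of H'
--     (length m ↦ m·k, and nothing in H' is shorter);
--   * an original vertex on it, and every internal vertex of the replacement
--     path of an edge on it, lies on the lift.
-- The geodetic property of S then covers the original vertices and the edge
-- geodetic property covers the new internal vertices.

open import Defs
open import Data.Nat using (ℕ; zero; suc; _+_; _*_; _≤_; _<_; _<?_; s≤s; z≤n)
open import Data.Nat.Properties
open import Data.Fin using (Fin; toℕ)
import Data.Fin.Properties as Fin
open import Data.Fin.Subset using (Subset)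
open import Data.Bool using (true; false)
import Data.Bool as Bool
open import Data.Sum using (_⊎_; inj₁; inj₂)
open import Data.Product using (Σ; _×_; _,_)
open import Data.Empty using (⊥; ⊥-elim)
open import Relation.Nullary using (yes; no)
open import Relation.Binary using (tri<; tri≈; tri>)
open import Relation.Binary.PropositionalEquality
open import Axiom.UniquenessOfIdentityProofs using (module Decidable⇒UIP)

module WalkConcat (G : Graph) where
  open Graph G

  infixr 5 _++_
  _++_ : ∀ {x y z a b} → Walk G x y a → Walk G y z b → Walk G x z (a + b)
  []      ++ w = w
  (e ∷ v) ++ w = e ∷ (v ++ w)

  on-start : ∀ {x y l} (w : Walk G x y l) → VertexOn G x w
  on-start []      = here-[]
  on-start (e ∷ w) = here-∷ e w

  on-++ˡ : ∀ {x y z a b v} {w₁ : Walk G x y a} (w₂ : Walk G y z b) →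
           VertexOn G v w₁ → VertexOn G v (w₁ ++ w₂)
  on-++ˡ w₂ here-[]      = on-start w₂
  on-++ˡ w₂ (here-∷ e w) = here-∷ e (w ++ w₂)
  on-++ˡ w₂ (there e on) = there e (on-++ˡ w₂ on)

  on-++ʳ : ∀ {x y z a b v} (w₁ : Walk G x y a) {w₂ : Walk G y z b} →
           VertexOn G v w₂ → VertexOn G v (w₁ ++ w₂)
  on-++ʳ []       on = on
  on-++ʳ (e ∷ w₁) on = there e (on-++ʳ w₁ on)

module Subdivided {n : ℕ} (H : SimpleGraph n) (k' : ℕ) where
  k : ℕ
  k = suc k'

  open SimpleGraph H
  open Subdivision H k
  open HEdge
  open WalkConcat (subdivide H k)

  W : Fin n → Fin n → ℕ → Set
  W = Walk (toGraph H)

  W' : V' → V' → ℕ → Set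
  W' = Walk (subdivide H k)

  -- an edge of H is determined by its endpoints (the proofs it carries are irrelevant)
  edge-≡ : ∀ {e e' : HEdge} → src e ≡ src e' → tgt e ≡ tgt e' → e ≡ e'
  edge-≡ {edge s t l a} {edge .s .t l' a'} refl refl
    rewrite Fin.<-irrelevant l l' | Decidable⇒UIP.≡-irrelevant Bool._≟_ a a' = refl

  node-beyond : ∀ e p → 1 ≤ p → k ≤ p → node e p ≡ inj₁ (tgt e)
  node-beyond e (suc q) _ k≤p with suc q <? k
  ... | yes p<k = ⊥-elim (<-irrefl refl (<-≤-trans p<k k≤p))
  ... | no  _   = refl

  node-inner : ∀ e p (1≤p : 1 ≤ p) (p<k : p < k) → node e p ≡ inj₂ (inner e p 1≤p p<k)
  node-inner e (suc q) 1≤p p<k with suc q <? k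
  ... | yes p<k' rewrite ≤-irrelevant 1≤p (s≤s z≤n) | <-irrelevant p<k p<k' = refl
  ... | no  p≮k  = ⊥-elim (p≮k p<k)

  climb : ∀ e p r → r + p ≡ k' → W' (node e p) (inj₁ (tgt e)) (suc r)
  climb e p zero refl =
    (e , p , ≤-refl , inj₁ (refl , node-beyond e k (s≤s z≤n) ≤-refl)) ∷ []
  climb e p (suc r) eq =
    (e , p , s≤s (subst (p ≤_) eq (m≤n+m p (suc r))) , inj₁ (refl , refl))
      ∷ climb e (suc p) r (trans (+-suc r p) eq)

  climb-visits : ∀ e p r (eq : r + p ≡ k') j → p ≤ j → j ≤ k' →
                 VertexOn (subdivide H k) (node e j) (climb e p r eq)
  climb-visits e p zero refl j p≤j j≤k' with ≤-antisym j≤k' p≤j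
  ... | refl = here-∷ _ _
  climb-visits e p (suc r) eq j p≤j j≤k' with m≤n⇒m<n∨m≡n p≤j
  ... | inj₂ refl = here-∷ _ _
  ... | inj₁ p<j  = there _ (climb-visits e (suc p) r _ j p<j j≤k')

  descend : ∀ e p → p ≤ k → W' (node e p) (inj₁ (src e)) p
  descend e zero    _   = []
  descend e (suc q) q<k = (e , q , q<k , inj₂ (refl , refl)) ∷ descend e q (<⇒≤ q<k)

  descend-visits : ∀ e p (p≤k : p ≤ k) j → j ≤ p →
                   VertexOn (subdivide H k) (node e j) (descend e p p≤k)
  descend-visits e zero    _   zero z≤n = here-[]
  descend-visits e (suc q) q<k j    j≤p with m≤n⇒m<n∨m≡n j≤p
  ... | inj₂ refl      = here-∷ _ _
  ... | inj₁ (s≤s j≤q) = there _ (descend-visits e q (<⇒≤ q<k) j j≤q)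

  forward : ∀ e → W' (inj₁ (src e)) (inj₁ (tgt e)) k
  forward e = climb e 0 k' (+-identityʳ k')

  backward : ∀ e → W' (inj₁ (tgt e)) (inj₁ (src e)) k
  backward e = (e , k' , ≤-refl , inj₂ (refl , node-beyond e k (s≤s z≤n) ≤-refl))
                 ∷ descend e k' (n≤1+n k')

  Ends : HEdge → Fin n → Fin n → Set
  Ends e a b = (src e ≡ a × tgt e ≡ b) ⊎ (tgt e ≡ a × src e ≡ b)

  step : ∀ a b → adj a b ≡ true → W' (inj₁ a) (inj₁ b) k
  step a b ab with Fin.<-cmp a b
  ... | tri< a<b _ _ = forward (edge a b a<b ab)
  ... | tri≈ _ refl _ = ⊥-elim (loop (trans (sym ab) (adj-irr a)))
    where loop : true ≡ false → ⊥
          loop ()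
  ... | tri> _ _ b<a = backward (edge b a b<a (trans (adj-sym b a) ab))

  step-visits : ∀ e j → j ≤ k' → ∀ {a b} → Ends e a b → (ab : adj a b ≡ true) →
                VertexOn (subdivide H k) (node e j) (step a b ab)
  step-visits e j j≤k' {a} {b} ends ab with Fin.<-cmp a b | ends
  ... | tri< a<b _ _ | inj₁ (refl , refl) =
        subst (λ e″ → VertexOn (subdivide H k) (node e″ j) (forward (edge a b a<b ab)))
              (edge-≡ refl refl) (climb-visits _ 0 k' _ j z≤n j≤k')
  ... | tri< a<b _ _ | inj₂ (refl , refl) = ⊥-elim (<-asym a<b (lt e))
  ... | tri≈ _ a≡b _ | inj₁ (refl , refl) = ⊥-elim (<-irrefl (cong toℕ a≡b) (lt e))
  ... | tri≈ _ a≡b _ | inj₂ (refl , refl) = ⊥-elim (<-irrefl (cong toℕ (sym a≡b)) (lt e))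
  ... | tri> _ _ b<a | inj₁ (refl , refl) = ⊥-elim (<-asym b<a (lt e))
  ... | tri> _ _ b<a | inj₂ (refl , refl) =
        subst (λ e″ → VertexOn (subdivide H k) (node e″ j) (backward (edge b a b<a (trans (adj-sym b a) ab))))
              (edge-≡ refl refl) (there _ (descend-visits _ k' (n≤1+n k') j j≤k'))

  lift : ∀ {a b m} → W a b m → W' (inj₁ a) (inj₁ b) (m * k)
  lift [] = []
  lift (_∷_ {x} {y} ab w) = step x y ab ++ lift w

  lift-visits-vertex : ∀ {a b m v} {w : W a b m} →
                       VertexOn (toGraph H) v w → VertexOn (subdivide H k) (inj₁ v) (lift w)
  lift-visits-vertex here-[]                  = here-[]
  lift-visits-vertex (here-∷ e w)             = on-start (lift (e ∷ w))
  lift-visits-vertex (there {u} {y} e {w} on) = on-++ʳ (step u y e) (lift-visits-vertex on)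

  lift-visits-step : ∀ {a b u v m x} {w : W u v m} → StepOn (toGraph H) a b w →
                     (∀ ab → VertexOn (subdivide H k) x (step a b ab)) →
                     VertexOn (subdivide H k) x (lift w)
  lift-visits-step (here ab w)             on-step = on-++ˡ (lift w) (on-step ab)
  lift-visits-step (there {u} {y} ab st) on-step = on-++ʳ (step u y ab) (lift-visits-step st on-step)

  lift-visits-edge : ∀ e j → j ≤ k' → ∀ {u v m} {w : W u v m} →
                     EdgeOn (toGraph H) (src e) (tgt e) w →
                     VertexOn (subdivide H k) (node e j) (lift w)
  lift-visits-edge e j j≤k' (inj₁ st) = lift-visits-step st (step-visits e j j≤k' (inj₁ (refl , refl)))
  lift-visits-edge e j j≤k' (inj₂ st) = lift-visits-step st (step-visits e j j≤k' (inj₂ (refl , refl)))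

  -- Lower bound on H'-walks ending at a fixed original vertex t: such a walk
  -- is at least k times as long as some H-walk to t from its start (or from an
  -- end of the replacement path through its start, plus the distance along it).
  module Towards (t : Fin n) where
    Reach : Fin n → ℕ → Set
    Reach a L = Σ ℕ λ m → W a t m × m * k ≤ L

    -- the vertex at position p of e's path reaches t within L, leaving via the
    -- source (p more edges) or via the target (k − p more edges, written additively)
    ReachAlong : HEdge → ℕ → ℕ → Set
    ReachAlong e p L = (Σ ℕ λ m → W (src e) t m × p + m * k ≤ L)
                     ⊎ (Σ ℕ λ m → W (tgt e) t m × k + m * k ≤ p + L)

    Bound : V' → ℕ → Set
    Bound (inj₁ a)                  L = Reach a L
    Bound (inj₂ (inner e p _ _)) L = ReachAlong e p L

    bound⇒along : ∀ e p → p ≤ k → ∀ {L} → Bound (node e p) L → ReachAlong e p L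
    bound⇒along e zero    _   r = inj₁ r
    bound⇒along e (suc q) p≤k {L} r with suc q <? k
    ... | yes _ = r
    ... | no p≮k with r
    ...   | m , w , le = inj₂ (m , w , subst (λ z → k + m * k ≤ z + L)
                                             (≤-antisym (≮⇒≥ p≮k) p≤k) (+-monoʳ-≤ k le))

    along⇒bound : ∀ e p → p ≤ k → ∀ {L} → ReachAlong e p L → Bound (node e p) L
    along⇒bound e zero _ (inj₁ r)            = r
    along⇒bound e zero _ (inj₂ (m , w , le)) = suc m , isEdge e ∷ w , le
    along⇒bound e (suc q) p≤k r with suc q <? k
    ... | yes _ = r
    along⇒bound e (suc q) p≤k {L} (inj₁ (m , w , le)) | no p≮k =
      suc m , trans (adj-sym _ _) (isEdge e) ∷ w ,
      subst (λ z → z + m * k ≤ L) (≤-antisym p≤k (≮⇒≥ p≮k)) le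
    along⇒bound e (suc q) p≤k {L} (inj₂ (m , w , le)) | no p≮k =
      m , w , +-cancelˡ-≤ k _ _ (subst (λ z → k + m * k ≤ z + L) (≤-antisym p≤k (≮⇒≥ p≮k)) le)

    along-back : ∀ e q {L} → ReachAlong e (suc q) L → ReachAlong e q (suc L)
    along-back e q (inj₁ (m , w , le))     = inj₁ (m , w , m≤n⇒m≤1+n (<⇒≤ le))
    along-back e q {L} (inj₂ (m , w , le)) = inj₂ (m , w , subst (k + m * k ≤_) (sym (+-suc q L)) le)

    along-forth : ∀ e q {L} → ReachAlong e q L → ReachAlong e (suc q) (suc L)
    along-forth e q (inj₁ (m , w , le))     = inj₁ (m , w , s≤s le)
    along-forth e q {L} (inj₂ (m , w , le)) =
      inj₂ (m , w , ≤-trans le (m≤n⇒m≤1+n (+-monoʳ-≤ q (n≤1+n L))))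

    bound : ∀ {x L} → W' x (inj₁ t) L → Bound x L
    bound [] = 0 , [] , z≤n
    bound ((e , q , q<k , inj₁ (refl , refl)) ∷ rest) =
      along⇒bound e q (<⇒≤ q<k) (along-back e q (bound⇒along e (suc q) q<k (bound rest)))
    bound ((e , q , q<k , inj₂ (refl , refl)) ∷ rest) =
      along⇒bound e (suc q) q<k (along-forth e q (bound⇒along e q (<⇒≤ q<k) (bound rest)))

  -- lifting preserves shortness: an H'-walk competing with lift w bounds an
  -- H-walk of m edges with m·k ≤ its length, and l ≤ m since w is shortest
  lift-shortest : ∀ {a b l} (w : W a b l) → Shortest (toGraph H) w → Shortest (subdivide H k) (lift w)
  lift-shortest {b = b} w shortest w' with Towards.bound b w'
  ... | m , wm , mk≤L = ≤-trans (*-monoˡ-≤ k (shortest wm)) mk≤L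

lemma13 : ∀ {n} (H : SimpleGraph n) (S : Subset n) (k : ℕ) → 1 ≤ k →
    IsGeodetic (toGraph H) (inH S) → IsEdgeGeodetic (toGraph H) (inH S) →
    IsGeodetic (subdivide H k) (inH' H k S)
lemma13 H S (suc k') _ geo _ (inj₁ v) with geo v
... | u , w , u∈S , w∈S , l , path , shortest , v-on =
  inj₁ u , inj₁ w , (u , refl , u∈S) , (w , refl , w∈S) ,
  l * suc k' , lift path , lift-shortest path shortest , lift-visits-vertex v-on
  where open Subdivided H k'
lemma13 H S (suc k') _ _ egeo (inj₂ (Subdivision.inner e p 1≤p p<k))
  with egeo (Subdivision.HEdge.src e) (Subdivision.HEdge.tgt e) (Subdivision.HEdge.isEdge e)
... | u , w , u∈S , w∈S , l , path , shortest , e-on =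
  inj₁ u , inj₁ w , (u , refl , u∈S) , (w , refl , w∈S) ,
  l * suc k' , lift path , lift-shortest path shortest ,
  subst (λ x → VertexOn (subdivide H (suc k')) x (lift path))
        (node-inner e p 1≤p p<k) (lift-visits-edge e p (≤-pred p<k) e-on)
  where open Subdivided H k'
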